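{- For all integers $i,d,k$ with $d\le k$, every incidence graph $G\in\mathscr{C}_d$ and every $(i,d,k)$-obstruction-tree $T$ of $G$, we have $|V(T)|\le 3^{i-d}\cdot\lambda_k$ and $|N^\dagger_G(T)|\le 3^{i-d}\cdot\lambda_k\cdot d$, where $\lambda_k=4\cdot 2^k$.
   Context: CNF formulas are identified with incidence graphs: bipartite graphs on variables and clauses, with a positive edge $\{x,c\}$ if $x_+\in c$ and a negative edge if $x_-\in c$ (no clause contains both $x_+$ and $x_-$). The width of a clause is its number of variables; $\mathscr{C}_d$ is the class of formulas whose clauses all have width at most $d$; a $d$-clause is a clause of width exactly $d$. Let $\lambda_k=4\cdot 2^k$. For integers $k,d$ and $G\in\mathscr{C}_d$, the $(i,d,k)$-obstruction-trees $T$ of $G$ (for $i\ge d$), their element sets $V(T)$ (with $\mathrm{cla}(T)$, $\mathrm{var}(T)$ the clauses and variables in $V(T)$) and destroy-neighborhoods $N^\dagger_G(T)$ are defined inductively: (1) if $c$ is a $d$-clause of $G$ with variables $x_1,\dots,x_d$, then $T=\{c,x_1,\dots,x_d\}$ is a $(d,d,k)$-obstruction-tree with $V(T)=T$ and $N^\dagger_G(T)=\{x_1,\dots,x_d\}$; (2) if $T_1,T_2$ are $(i,d,k)$-obstruction-trees of $G$ with $N^\dagger_G(T_1)\cap N^\dagger_G(T_2)=\emptyset$ and $P$ is a path in $G$ of length at most $\lambda_k$ connecting a vertex of $T_1$ and a vertex of $T_2$, then $T=(T_1,P,T_2)$ is an $(i+1,d,k)$-obstruction-tree with $V(T)=V(T_1)\cup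 V(P)\cup V(T_2)$ and $N^\dagger_G(T)=\mathrm{var}(T)\cup\{x:\ \text{there are } c_1,c_2\in\mathrm{cla}(T)\text{ with } \{x,c_1\} \text{ a positive edge and } \{x,c_2\} \text{ a negative edge}\}$. -}

module Defs where

open import Data.Nat using (ℕ; zero; suc; _+_; _*_; _^_; _≤_)
open import Data.Fin using (Fin; zero; suc)
open import Data.Bool using (Bool; true; false; _∧_; _∨_; if_then_else_)
open import Data.Sum using (_⊎_; inj₁; inj₂)
open import Data.Sum.Properties using (≡-dec)
open import Data.List using (List; []; _∷_; length)
open import Data.Bool.ListAction using (any)
open import Data.Product using (_×_)
open import Data.List.Relation.Unary.Unique.Propositional using (Unique)
open import Data.Empty using (⊥)
open import Relation.Binary.PropositionalEquality using (_≡_)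
open import Relation.Nullary using (¬_)
open import Relation.Nullary.Decidable using (⌊_⌋)
import Data.Fin.Properties as FinP

-- CNF formulas as signed incidence graphs.
-- Variables are Fin n, clauses are Fin m.  inc c x says whether the
-- variable x occurs in c positively (pos), negatively (neg), or not at all
-- (none).  A clause thus never contains both x₊ and x₋.

data Sign : Set where
  none pos neg : Sign

isPos isNeg occurs : Sign → Bool
isPos pos = true
isPos _   = false
isNeg neg = true
isNeg _   = false
occurs none = false
occurs _    = true

record Formula (n m : ℕ) : Set where
  field
    inc : Fin m → Fin n → Sign
open Formula public

countB : ∀ {N} → (Fin N → Bool) → ℕ
countB {zero}  p = 0
countB {suc N} p = (if p zero then 1 else 0) + countB (λ i → p (suc i))

anyFin : ∀ {N} → (Fin N → Bool) → Bool
anyFin {zero}  p = false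
anyFin {suc N} p = p zero ∨ anyFin (λ i → p (suc i))

module _ {n m : ℕ} (G : Formula n m) where

  width : Fin m → ℕ
  width c = countB (λ x → occurs (inc G c x))

  Vertex : Set
  Vertex = Fin n ⊎ Fin m

  _≟V_ : (u v : Vertex) → Bool
  u ≟V v = ⌊ ≡-dec FinP._≟_ FinP._≟_ u v ⌋

  data Adj : Vertex → Vertex → Set where
    vc : ∀ {x c} → occurs (inc G c x) ≡ true → Adj (inj₁ x) (inj₂ c)
    cv : ∀ {x c} → occurs (inc G c x) ≡ true → Adj (inj₂ c) (inj₁ x)

  data Walk : Vertex → List Vertex → Set where
    [] : ∀ {v} → Walk v []
    _∷_ : ∀ {u v vs} → Adj u v → Walk v vs → Walk u (v ∷ vs)

  -- a path: a walk with pairwise distinct vertices; its length is length vs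
  IsPath : Vertex → List Vertex → Set
  IsPath v vs = Walk v vs × Unique (v ∷ vs)

  endOf : Vertex → List Vertex → Vertex
  endOf v []       = v
  endOf v (w ∷ ws) = endOf w ws

InC : ∀ {n m} → ℕ → Formula n m → Set
InC d G = ∀ c → width G c ≤ d

lam : ℕ → ℕ
lam k = 4 * 2 ^ k

-- Raw obstruction trees: either a clause (leaf), or (T₁, P, T₂) where the
-- path P is given by its start vertex and the list of remaining vertices.

data RawTree (n m : ℕ) : Set where
  leaf : Fin m → RawTree n m
  node : RawTree n m → (Fin n ⊎ Fin m) → List (Fin n ⊎ Fin m) → RawTree n m → RawTree n m

module _ {n m : ℕ} (G : Formula n m) where

  memV : RawTree n m → Vertex G → Bool
  memV (leaf c) (inj₁ x) = occurs (inc G c x)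
  memV (leaf c) (inj₂ c') = _≟V_ G (inj₂ c) (inj₂ c')
  memV (node T₁ v vs T₂) u =
    memV T₁ u ∨ any (λ w → _≟V_ G w u) (v ∷ vs) ∨ memV T₂ u

  memN : RawTree n m → Fin n → Bool
  memN (leaf c) x = occurs (inc G c x)
  memN T@(node _ _ _ _) x =
    memV T (inj₁ x)
    ∨ (anyFin (λ c → memV T (inj₂ c) ∧ isPos (inc G c x))
       ∧ anyFin (λ c → memV T (inj₂ c) ∧ isNeg (inc G c x)))

  sizeV : RawTree n m → ℕ
  sizeV T = countB (λ x → memV T (inj₁ x)) + countB (λ c → memV T (inj₂ c))

  sizeN : RawTree n m → ℕ
  sizeN T = countB (memN T)

  DisjointN : RawTree n m → RawTree n m → Set
  DisjointN T₁ T₂ = ∀ x → memN T₁ x ≡ true → memN T₂ x ≡ true → ⊥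

  data ObsTree (d k : ℕ) : ℕ → RawTree n m → Set where
    leafOT : ∀ {c} → width G c ≡ d → ObsTree d k d (leaf c)
    nodeOT : ∀ {i T₁ T₂ v vs} →
      ObsTree d k i T₁ → ObsTree d k i T₂ →
      DisjointN T₁ T₂ →
      IsPath G v vs → length vs ≤ lam k →
      memV T₁ v ≡ true → memV T₂ (endOf G v vs) ≡ true →
      ObsTree d k (suc i) (node T₁ v vs T₂)

module Submission where

open import Defs
open import Data.Nat using (ℕ; zero; suc; _+_; _*_; _^_; _∸_; _≤_; _<_; z≤n; s≤s)
open import Data.Nat.Properties
open import Data.Fin using (Fin; zero; suc)
import Data.Fin.Properties as FinP
open import Data.Bool using (Bool; true; false; _∧_; _∨_; if_then_else_)
open import Data.Sum using (_⊎_; inj₁; inj₂)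
open import Data.Sum.Properties using (≡-dec; inj₁-injective; inj₂-injective)
open import Data.List using (List; []; _∷_; length)
open import Data.Bool.ListAction using (any)
open import Data.Product using (Σ; _×_; _,_; proj₁)
open import Data.Empty using (⊥-elim)
open import Function using (_∘_)
open import Relation.Binary.PropositionalEquality
open import Relation.Nullary using (yes; no)
open import Algebra.Properties.CommutativeSemigroup +-commutativeSemigroup using (interchange)

-- By induction on the tree: a leaf has d + 1 ≤ λ_k elements, and V(T₁,P,T₂)
-- is covered by V(T₁), V(T₂) and the at most λ_k vertices of P after its
-- start (which lies in T₁), so |V(T)| ≤ 3^(i-1-d)λ_k + λ_k + 3^(i-1-d)λ_k.
-- For N†: every variable of N†(T) occurs in some clause of T (a variable on
-- P is preceded on P by a clause containing it), and each clause has at most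
-- d variables, so |N†(T)| ≤ d · |cla(T)| ≤ d · |V(T)|.

∨-true⁻ : ∀ a {b} → a ∨ b ≡ true → a ≡ true ⊎ b ≡ true
∨-true⁻ true  _ = inj₁ refl
∨-true⁻ false e = inj₂ e

∨-trueˡ : ∀ {a} b → a ≡ true → a ∨ b ≡ true
∨-trueˡ _ refl = refl

∨-trueʳ : ∀ a {b} → b ≡ true → a ∨ b ≡ true
∨-trueʳ true  _ = refl
∨-trueʳ false e = e

∧-true⁻ : ∀ a {b} → a ∧ b ≡ true → a ≡ true × b ≡ true
∧-true⁻ true e = refl , e

∧-true⁺ : ∀ {a b} → a ≡ true → b ≡ true → a ∧ b ≡ true
∧-true⁺ refl refl = refl

true≢false : true ≢ false
true≢false ()

countB-mono : ∀ {N} {p q : Fin N → Bool} → (∀ i → p i ≡ true → q i ≡ true) →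
  countB p ≤ countB q
countB-mono {zero} h = z≤n
countB-mono {suc N} {p} {q} h with p zero in ep | q zero in eq
... | true  | true  = s≤s (countB-mono (λ i → h (suc i)))
... | true  | false = ⊥-elim (true≢false (trans (sym (h zero ep)) eq))
... | false | true  = m≤n⇒m≤1+n (countB-mono (λ i → h (suc i)))
... | false | false = countB-mono (λ i → h (suc i))

countB-∨ : ∀ {N} (p q : Fin N → Bool) → countB (λ i → p i ∨ q i) ≤ countB p + countB q
countB-∨ {zero} p q = z≤n
countB-∨ {suc N} p q with p zero | q zero | countB-∨ (λ i → p (suc i)) (λ i → q (suc i))
... | true  | true  | rec = s≤s (≤-trans rec (+-monoʳ-≤ _ (n≤1+n _)))
... | true  | false | rec = s≤s rec
... | false | true  | rec = ≤-trans (s≤s rec) (≤-reflexive (sym (+-suc _ _)))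
... | false | false | rec = rec

countB-none : ∀ {N} (p : Fin N → Bool) → (∀ i → p i ≢ true) → countB p ≡ 0
countB-none {zero} p h = refl
countB-none {suc N} p h with p zero in e
... | true  = ⊥-elim (h zero e)
... | false = countB-none (λ i → p (suc i)) (λ i → h (suc i))

countB-false : ∀ {N} → countB {N} (λ _ → false) ≡ 0
countB-false {N} = countB-none {N} (λ _ → false) (λ _ ())

countB-≤1 : ∀ {N} {p : Fin N → Bool} → (∀ i j → p i ≡ true → p j ≡ true → i ≡ j) →
  countB p ≤ 1
countB-≤1 {zero} h = z≤n
countB-≤1 {suc N} {p} h with p zero in e
... | true  = s≤s (≤-reflexive (countB-none _ (λ i eᵢ → zero≢suc (h zero (suc i) e eᵢ))))
  where
    zero≢suc : ∀ {i : Fin N} → zero ≢ suc i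
    zero≢suc ()
... | false = countB-≤1 (λ i j eᵢ eⱼ → FinP.suc-injective (h (suc i) (suc j) eᵢ eⱼ))

anyFin⁺ : ∀ {N} (p : Fin N → Bool) (i : Fin N) → p i ≡ true → anyFin p ≡ true
anyFin⁺ p zero    e = ∨-trueˡ _ e
anyFin⁺ p (suc i) e = ∨-trueʳ (p zero) (anyFin⁺ (λ j → p (suc j)) i e)

anyFin⁻ : ∀ {N} (p : Fin N → Bool) → anyFin p ≡ true → Σ (Fin N) λ i → p i ≡ true
anyFin⁻ {suc N} p e with ∨-true⁻ (p zero) e
... | inj₁ p0 = zero , p0
... | inj₂ e′ with anyFin⁻ (λ j → p (suc j)) e′
...   | i , pi = suc i , pi

countB-⋃ : ∀ {N M} d (P : Fin M → Bool) (R : Fin M → Fin N → Bool) →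
  (∀ c → countB (R c) ≤ d) →
  countB (λ x → anyFin (λ c → P c ∧ R c x)) ≤ d * countB P
countB-⋃ {N} {zero} d P R h = ≤-reflexive (trans (countB-false {N}) (sym (*-zeroʳ d)))
countB-⋃ {N} {suc M} d P R h = begin
  countB (λ x → (P zero ∧ R zero x) ∨ anyFin (λ c → P (suc c) ∧ R (suc c) x))
    ≤⟨ countB-∨ (λ x → P zero ∧ R zero x) (λ x → anyFin (λ c → P (suc c) ∧ R (suc c) x)) ⟩
  countB (λ x → P zero ∧ R zero x) + countB (λ x → anyFin (λ c → P (suc c) ∧ R (suc c) x))
    ≤⟨ +-mono-≤ (selected (P zero))
                (countB-⋃ d (λ c → P (suc c)) (λ c → R (suc c)) (λ c → h (suc c))) ⟩
  d * (if P zero then 1 else 0) + d * countB (λ c → P (suc c))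
    ≡⟨ *-distribˡ-+ d _ _ ⟨
  d * countB P ∎
  where
    open ≤-Reasoning
    selected : ∀ b → countB (λ x → b ∧ R zero x) ≤ d * (if b then 1 else 0)
    selected true  = subst (_ ≤_) (sym (*-identityʳ d)) (h zero)
    selected false = ≤-reflexive (trans (countB-false {N}) (sym (*-zeroʳ d)))

n<2^n : ∀ n → n < 2 ^ n
n<2^n zero    = s≤s z≤n
n<2^n (suc n) = +-mono-≤-< (m^n>0 2 n) (m≤n⇒m≤n+o 0 (n<2^n n))

≤⇒<lam : ∀ {d k} → d ≤ k → d < lam k
≤⇒<lam {k = k} d≤k = ≤-trans (s≤s d≤k) (≤-trans (n<2^n k) (m≤n*m (2 ^ k) 4))

module _ {n m : ℕ} (G : Formula n m) where

  countVertices : (Vertex G → Bool) → ℕ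
  countVertices p = countB (λ x → p (inj₁ x)) + countB (λ c → p (inj₂ c))

  countVertices-mono : {p q : Vertex G → Bool} → (∀ u → p u ≡ true → q u ≡ true) →
    countVertices p ≤ countVertices q
  countVertices-mono h = +-mono-≤ (countB-mono (λ x → h (inj₁ x))) (countB-mono (λ c → h (inj₂ c)))

  countVertices-∨ : (p q : Vertex G → Bool) →
    countVertices (λ u → p u ∨ q u) ≤ countVertices p + countVertices q
  countVertices-∨ p q = begin
    countVertices (λ u → p u ∨ q u)
      ≤⟨ +-mono-≤ (countB-∨ (λ x → p (inj₁ x)) (λ x → q (inj₁ x)))
                  (countB-∨ (λ c → p (inj₂ c)) (λ c → q (inj₂ c))) ⟩
    (p₁ + q₁) + (p₂ + q₂)
      ≡⟨ interchange p₁ q₁ p₂ q₂ ⟩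
    (p₁ + p₂) + (q₁ + q₂) ∎
    where
      open ≤-Reasoning
      p₁ q₁ p₂ q₂ : ℕ
      p₁ = countB (λ x → p (inj₁ x))
      q₁ = countB (λ x → q (inj₁ x))
      p₂ = countB (λ c → p (inj₂ c))
      q₂ = countB (λ c → q (inj₂ c))

  ≟V-sound : ∀ {w u} → _≟V_ G w u ≡ true → w ≡ u
  ≟V-sound {w} {u} e with ≡-dec FinP._≟_ FinP._≟_ w u
  ... | yes w≡u = w≡u
  ... | no  _   = ⊥-elim (true≢false (sym e))

  ≟V-refl : ∀ w → _≟V_ G w w ≡ true
  ≟V-refl w with ≡-dec FinP._≟_ FinP._≟_ w w
  ... | yes _ = refl
  ... | no w≢w = ⊥-elim (w≢w refl)

  countVertices-≟V : ∀ w → countVertices (_≟V_ G w) ≤ 1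
  countVertices-≟V (inj₁ y) =
    +-mono-≤ (countB-≤1 (λ _ _ eᵢ eⱼ → inj₁-injective (trans (sym (≟V-sound eᵢ)) (≟V-sound eⱼ))))
             (≤-reflexive (countB-none (λ c → _≟V_ G (inj₁ y) (inj₂ c))
                                       (λ c e → inj₁≢inj₂ (≟V-sound {inj₁ y} {inj₂ c} e))))
    where
      inj₁≢inj₂ : ∀ {c} → inj₁ y ≢ inj₂ c
      inj₁≢inj₂ ()
  countVertices-≟V (inj₂ y) =
    +-mono-≤ (≤-reflexive (countB-none (λ x → _≟V_ G (inj₂ y) (inj₁ x))
                                       (λ x e → inj₂≢inj₁ (≟V-sound {inj₂ y} {inj₁ x} e))))
             (countB-≤1 (λ _ _ eᵢ eⱼ → inj₂-injective (trans (sym (≟V-sound eᵢ)) (≟V-sound eⱼ))))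
    where
      inj₂≢inj₁ : ∀ {x} → inj₂ y ≢ inj₁ x
      inj₂≢inj₁ ()

  _∈ᵇ_ : Vertex G → List (Vertex G) → Bool
  u ∈ᵇ vs = any (λ w → _≟V_ G w u) vs

  countVertices-∈ᵇ : ∀ vs → countVertices (_∈ᵇ vs) ≤ length vs
  countVertices-∈ᵇ [] =
    ≤-reflexive (cong₂ _+_ (countB-false {n}) (countB-false {m}))
  countVertices-∈ᵇ (w ∷ ws) =
    ≤-trans (countVertices-∨ (_≟V_ G w) (_∈ᵇ ws)) (+-mono-≤ (countVertices-≟V w) (countVertices-∈ᵇ ws))

  sizeV-leaf : ∀ c → sizeV G (leaf c) ≤ suc (width G c)
  sizeV-leaf c = ≤-trans (+-monoʳ-≤ (width G c) (≤-trans (m≤n+m _ _) (countVertices-≟V (inj₂ c))))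
                         (≤-reflexive (+-comm (width G c) 1))

  -- The start v of the path is absorbed into V(T₁).
  memV-node⁻ : ∀ T₁ v vs T₂ u → memV G T₁ v ≡ true → memV G (node T₁ v vs T₂) u ≡ true →
    memV G T₁ u ∨ (u ∈ᵇ vs ∨ memV G T₂ u) ≡ true
  memV-node⁻ T₁ v vs T₂ u v∈T₁ e with ∨-true⁻ (memV G T₁ u) e
  ... | inj₁ u∈T₁ = ∨-trueˡ _ u∈T₁
  ... | inj₂ e′ with ∨-true⁻ (u ∈ᵇ (v ∷ vs)) e′
  ...   | inj₂ u∈T₂ = ∨-trueʳ (memV G T₁ u) (∨-trueʳ (u ∈ᵇ vs) u∈T₂)
  ...   | inj₁ e″ with ∨-true⁻ (_≟V_ G v u) e″
  ...     | inj₁ v≡u  = ∨-trueˡ _ (subst (λ w → memV G T₁ w ≡ true) (≟V-sound {v} {u} v≡u) v∈T₁)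
  ...     | inj₂ u∈vs = ∨-trueʳ (memV G T₁ u) (∨-trueˡ _ u∈vs)

  sizeV-node : ∀ T₁ v vs T₂ → memV G T₁ v ≡ true →
    sizeV G (node T₁ v vs T₂) ≤ sizeV G T₁ + (length vs + sizeV G T₂)
  sizeV-node T₁ v vs T₂ v∈T₁ = begin
    countVertices (memV G (node T₁ v vs T₂))
      ≤⟨ countVertices-mono (λ u → memV-node⁻ T₁ v vs T₂ u v∈T₁) ⟩
    countVertices (λ u → memV G T₁ u ∨ (u ∈ᵇ vs ∨ memV G T₂ u))
      ≤⟨ countVertices-∨ (memV G T₁) (λ u → u ∈ᵇ vs ∨ memV G T₂ u) ⟩
    sizeV G T₁ + countVertices (λ u → u ∈ᵇ vs ∨ memV G T₂ u)
      ≤⟨ +-monoʳ-≤ (sizeV G T₁) (countVertices-∨ (_∈ᵇ vs) (memV G T₂)) ⟩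
    sizeV G T₁ + (countVertices (_∈ᵇ vs) + sizeV G T₂)
      ≤⟨ +-monoʳ-≤ (sizeV G T₁) (+-monoˡ-≤ (sizeV G T₂) (countVertices-∈ᵇ vs)) ⟩
    sizeV G T₁ + (length vs + sizeV G T₂) ∎
    where open ≤-Reasoning

  ObsTree⇒d≤i : ∀ {d k i T} → ObsTree G d k i T → d ≤ i
  ObsTree⇒d≤i (leafOT _)              = ≤-refl
  ObsTree⇒d≤i (nodeOT t₁ _ _ _ _ _ _) = m≤n⇒m≤1+n (ObsTree⇒d≤i t₁)

  sizeV-bound : ∀ {d k i T} → d < lam k → ObsTree G d k i T → sizeV G T ≤ 3 ^ (i ∸ d) * lam k
  sizeV-bound {d} {k} d<λ (leafOT {c} width≡d) = begin
    sizeV G (leaf c)     ≤⟨ sizeV-leaf c ⟩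
    suc (width G c)      ≡⟨ cong suc width≡d ⟩
    suc d                ≤⟨ d<λ ⟩
    lam k                ≡⟨ *-identityˡ (lam k) ⟨
    3 ^ 0 * lam k        ≡⟨ cong (λ j → 3 ^ j * lam k) (n∸n≡0 d) ⟨
    3 ^ (d ∸ d) * lam k  ∎
    where open ≤-Reasoning
  sizeV-bound {d} {k} {suc i} d<λ (nodeOT {T₁ = T₁} {T₂} {v} {vs} t₁ t₂ _ _ |vs|≤λ v∈T₁ _) = begin
    sizeV G (node T₁ v vs T₂)              ≤⟨ sizeV-node T₁ v vs T₂ v∈T₁ ⟩
    sizeV G T₁ + (length vs + sizeV G T₂)  ≤⟨ +-mono-≤ (sizeV-bound d<λ t₁)
                                                        (+-mono-≤ |vs|≤X (sizeV-bound d<λ t₂)) ⟩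
    X + (X + X)                            ≡⟨ cong (λ y → X + (X + y)) (+-identityʳ X) ⟨
    3 * X                                  ≡⟨ *-assoc 3 (3 ^ (i ∸ d)) (lam k) ⟨
    3 ^ suc (i ∸ d) * lam k                ≡⟨ cong (λ j → 3 ^ j * lam k) (+-∸-assoc 1 (ObsTree⇒d≤i t₁)) ⟨
    3 ^ (suc i ∸ d) * lam k                ∎
    where
      open ≤-Reasoning
      X : ℕ
      X = 3 ^ (i ∸ d) * lam k
      |vs|≤X : length vs ≤ X
      |vs|≤X = ≤-trans |vs|≤λ (m≤n*m (lam k) (3 ^ (i ∸ d)) {{m^n≢0 3 (i ∸ d)}})

  OccursInClauseOf : (Fin m → Bool) → Fin n → Set
  OccursInClauseOf p x = Σ (Fin m) λ c → p c ≡ true × occurs (inc G c x) ≡ true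

  OccursInClauseOf-mono : ∀ {p q x} → (∀ c → p c ≡ true → q c ≡ true) →
    OccursInClauseOf p x → OccursInClauseOf q x
  OccursInClauseOf-mono p⊆q (c , c∈p , x∈c) = c , p⊆q c c∈p , x∈c

  walk-variable-clause : ∀ {v vs x} → Walk G v vs → inj₁ x ∈ᵇ vs ≡ true →
    OccursInClauseOf (λ c → inj₂ c ∈ᵇ (v ∷ vs)) x
  walk-variable-clause {v} (vc _ ∷ walk) x∈ws =
    OccursInClauseOf-mono (λ c → ∨-trueʳ (_≟V_ G v (inj₂ c))) (walk-variable-clause walk x∈ws)
  walk-variable-clause {inj₂ c} {inj₁ y ∷ _} {x} (cv y∈c ∷ walk) e
    with ∨-true⁻ (_≟V_ G (inj₁ y) (inj₁ x)) e
  ... | inj₁ y≡x  = c , ∨-trueˡ _ (≟V-refl (inj₂ c)) ,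
                    subst (λ z → occurs (inc G c z) ≡ true) (inj₁-injective (≟V-sound y≡x)) y∈c
  ... | inj₂ x∈ws = OccursInClauseOf-mono (λ c′ → ∨-trueʳ (_≟V_ G (inj₂ c) (inj₂ c′)))
                                          (walk-variable-clause walk x∈ws)

  memV-variable-clause : ∀ {d k i T x} → ObsTree G d k i T → memV G T (inj₁ x) ≡ true →
    OccursInClauseOf (λ c → memV G T (inj₂ c)) x
  memV-variable-clause (leafOT {c} _) x∈c = c , ≟V-refl (inj₂ c) , x∈c
  memV-variable-clause {T = node T₁ v vs T₂} {x} (nodeOT t₁ t₂ _ (walk , _) _ v∈T₁ _) e
    with ∨-true⁻ (memV G T₁ (inj₁ x)) (memV-node⁻ T₁ v vs T₂ (inj₁ x) v∈T₁ e)
  ... | inj₁ x∈T₁ = OccursInClauseOf-mono (λ _ → ∨-trueˡ _) (memV-variable-clause t₁ x∈T₁)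
  ... | inj₂ e′ with ∨-true⁻ (inj₁ x ∈ᵇ vs) e′
  ...   | inj₁ x∈vs = OccursInClauseOf-mono (λ c → ∨-trueʳ (memV G T₁ (inj₂ c)) ∘ ∨-trueˡ _)
                        (walk-variable-clause walk x∈vs)
  ...   | inj₂ x∈T₂ = OccursInClauseOf-mono
                        (λ c → ∨-trueʳ (memV G T₁ (inj₂ c)) ∘ ∨-trueʳ (inj₂ c ∈ᵇ (v ∷ vs)))
                        (memV-variable-clause t₂ x∈T₂)

  memN-clause : ∀ {d k i T x} → ObsTree G d k i T → memN G T x ≡ true →
    OccursInClauseOf (λ c → memV G T (inj₂ c)) x
  memN-clause (leafOT {c} _) x∈c = c , ≟V-refl (inj₂ c) , x∈c
  memN-clause {T = T@(node _ _ _ _)} {x} t@(nodeOT _ _ _ _ _ _ _) e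
    with ∨-true⁻ (memV G T (inj₁ x)) e
  ... | inj₁ x∈T     = memV-variable-clause t x∈T
  ... | inj₂ conflict with anyFin⁻ _ (proj₁ (∧-true⁻ _ conflict))
  ...   | c , c∈T∧x⁺∈c with ∧-true⁻ (memV G T (inj₂ c)) c∈T∧x⁺∈c
  ...     | c∈T , x⁺∈c = c , c∈T , isPos⇒occurs (inc G c x) x⁺∈c
    where
      isPos⇒occurs : ∀ s → isPos s ≡ true → occurs s ≡ true
      isPos⇒occurs pos _ = refl

  sizeN≤*sizeV : ∀ {w d k i T} → InC w G → ObsTree G d k i T → sizeN G T ≤ w * sizeV G T
  sizeN≤*sizeV {w} {T = T} G∈𝒞 t = begin
    sizeN G T
      ≤⟨ countB-mono covered ⟩
    countB (λ x → anyFin (λ c → memV G T (inj₂ c) ∧ occurs (inc G c x)))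
      ≤⟨ countB-⋃ w (λ c → memV G T (inj₂ c)) (λ c x → occurs (inc G c x)) G∈𝒞 ⟩
    w * countB (λ c → memV G T (inj₂ c))
      ≤⟨ *-monoʳ-≤ w (m≤n+m _ _) ⟩
    w * sizeV G T ∎
    where
      open ≤-Reasoning
      covered : ∀ x → memN G T x ≡ true →
        anyFin (λ c → memV G T (inj₂ c) ∧ occurs (inc G c x)) ≡ true
      covered x e with memN-clause t e
      ... | c , c∈T , x∈c = anyFin⁺ _ c (∧-true⁺ c∈T x∈c)

proposition5p4 : ∀ {n m} (G : Formula n m) (i d k : ℕ) → d ≤ k → InC d G →
    (T : RawTree n m) → ObsTree G d k i T →
    sizeV G T ≤ 3 ^ (i ∸ d) * lam k × sizeN G T ≤ 3 ^ (i ∸ d) * lam k * d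
proposition5p4 G i d k d≤k G∈𝒞 T t = |V|≤ , (begin
    sizeN G T                  ≤⟨ sizeN≤*sizeV G G∈𝒞 t ⟩
    d * sizeV G T              ≤⟨ *-monoʳ-≤ d |V|≤ ⟩
    d * (3 ^ (i ∸ d) * lam k)  ≡⟨ *-comm d _ ⟩
    3 ^ (i ∸ d) * lam k * d    ∎)
  where
    open ≤-Reasoning
    |V|≤ : sizeV G T ≤ 3 ^ (i ∸ d) * lam k
    |V|≤ = sizeV-bound G (≤⇒<lam d≤k) t
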